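{- For every permutation $\pi\in S_n$, $P_\pi=S(Z(A_\pi)+B_{n+2})$ over $\mathbb F_2$, where $A_\pi$ is the adjacency matrix and $P_\pi$ the precedence matrix of $\pi$.
   Context: Frame $\pi=[a_1,\dots,a_n]$ as $0,a_1,\dots,a_n,n+1$; each entry $k$ has a left pointer $(k-1,k)$ immediately left and right pointer $(k,k+1)$ immediately right (none left of $0$, none right of $n+1$). $A_\pi$ is the $(n+1)\times(n+1)$ matrix over $\mathbb F_2$ with $A_\pi(i,j)=1$ iff the pointers $(i-1,i)$ and $(j-1,j)$ interleave (exactly one occurrence of one lies strictly between the two occurrences of the other). With $f_\pi(0)=0$, $f_\pi(a_i)=i$, $f_\pi(n+1)=n+1$, $P_\pi$ is the $(n+2)\times(n+2)$ matrix with $P_\pi(i,j)=1$ iff $f_\pi(i-1)<f_\pi(j-1)$. For an $m\times m$ matrix $A$, $Z(A)$ is the $(m+1)\times(m+1)$ matrix with $Z(A)(1,1)=1$, $Z(A)(i,j)=0$ if exactly one of $i,j$ equals $1$, and $Z(A)(i,j)=A(i-1,j-1)$ otherwise. For an $m\times m$ matrix $M$, $S(M)(i,j)=\sum_{r=1}^i\sum_{c=1}^j M(r,c)\bmod 2$. $B_k$ is the $k\times k$ matrix with $B_k(i,j)=1$ iff $i=j$ or $i+1=j$. -}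

module Defs where

open import Data.Bool using (Bool; true; false; _xor_; _∧_; not)
open import Data.Nat using (ℕ; zero; suc; _+_; _*_; _<?_; _⊔_; _⊓_)
open import Data.Fin using (Fin; zero; suc; toℕ; fromℕ<)
import Data.Fin as F
open import Data.Fin.Permutation using (Permutation′; _⟨$⟩ʳ_; _⟨$⟩ˡ_)
open import Relation.Nullary.Decidable using (⌊_⌋; yes; no)

-- F₂ is modelled as Bool: addition is _xor_, multiplication _∧_.
-- Matrices are functions Fin m → Fin m → Bool, indexed 0-based
-- (paper's index i corresponds to Fin index i-1).
Mat : ℕ → Set
Mat m = Fin m → Fin m → Bool

-- A permutation π ∈ S_n, π = [a_1,…,a_n] with a_i = 1 + toℕ (π ⟨$⟩ʳ (i-1)).

-- f_π on the framed values 0,…,n+1 (given as natural numbers):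
-- f(0) = 0, f(a_i) = i, f(n+1) = n+1.
fπ : ∀ {n} → Permutation′ n → ℕ → ℕ
fπ {n} π zero = zero
fπ {n} π (suc k) with k <? n
... | yes p = suc (toℕ (π ⟨$⟩ˡ fromℕ< p))
... | no _  = suc n

-- Linear coordinates in the framed word 0,a_1,…,a_n,n+1 with pointers:
-- the entry at position p sits at coordinate 3p+1, its left pointer at 3p,
-- its right pointer at 3p+2.
-- Pointer (k-1,k) (k = 1,…,n+1) occurs as the left pointer of entry k
-- and as the right pointer of entry k-1.
occL : ∀ {n} → Permutation′ n → ℕ → ℕ
occL π k = 3 * fπ π k

occR : ∀ {n} → Permutation′ n → ℕ → ℕ
occR π k = 3 * fπ π (k Data.Nat.∸ 1) + 2

strictlyBetween : ℕ → ℕ → ℕ → Bool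
strictlyBetween a b x = ⌊ (a ⊓ b) <? x ⌋ ∧ ⌊ x <? (a ⊔ b) ⌋

interleave : ∀ {n} → Permutation′ n → ℕ → ℕ → Bool
interleave π i j =
  strictlyBetween (occL π i) (occR π i) (occL π j)
  xor strictlyBetween (occL π i) (occR π i) (occR π j)

-- Adjacency matrix A_π, (n+1)×(n+1); Fin index r ↦ paper index r+1,
-- i.e. pointer (r, r+1).
Aπ : ∀ {n} → Permutation′ n → Mat (suc n)
Aπ π r s = interleave π (suc (toℕ r)) (suc (toℕ s))

-- Precedence matrix P_π, (n+2)×(n+2): P(i,j)=1 iff f(i-1) < f(j-1);
-- Fin index r ↦ paper index r+1, so the entry is f(r) < f(s).
Pπ : ∀ {n} → Permutation′ n → Mat (suc (suc n))
Pπ π r s = ⌊ fπ π (toℕ r) <? fπ π (toℕ s) ⌋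

Z : ∀ {m} → Mat m → Mat (suc m)
Z A zero    zero    = true
Z A zero    (suc _) = false
Z A (suc _) zero    = false
Z A (suc i) (suc j) = A i j

B : ∀ k → Mat k
B k i j = ⌊ toℕ i Data.Nat.≟ toℕ j ⌋ Data.Bool.∨ ⌊ suc (toℕ i) Data.Nat.≟ toℕ j ⌋

_⊕_ : ∀ {m} → Mat m → Mat m → Mat m
(M ⊕ N) i j = M i j xor N i j

xorSum : ∀ {k} → (Fin k → Bool) → Bool
xorSum {zero}  g = false
xorSum {suc k} g = g zero xor xorSum (λ r → g (suc r))

S : ∀ {m} → Mat m → Mat m
S M i j = xorSum λ r → xorSum λ c →
  ⌊ r F.≤? i ⌋ ∧ ⌊ c F.≤? j ⌋ ∧ M r c

-- S is the two-dimensional prefix sum over F₂; its inverse is the mixed difference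
-- Δ₂ P (r , c) = P(r,c) + P(r-1,c) + P(r,c-1) + P(r-1,c-1).  So it suffices to check,
-- entry by entry, that Z(A_π) + B is the mixed difference of the precedence relation
-- f(a) < f(b).  A point z lies strictly between a and b iff exactly one of a < z, b < z
-- holds, and the pointer (r,r+1) sits at positions 3 f(r+1) and 3 f(r) + 2.  Hence the
-- pointers (r,r+1) and (c,c+1) interleave iff
--   [f(r+1) < f(c+1)] + [f(r) < f(c+1)] + [f(r+1) ≤ f(c)] + [f(r) < f(c)] = 1,
-- which differs from the mixed difference exactly by [f(r+1) = f(c)] = [r+1 = c], the
-- superdiagonal of B.  On the diagonal the pointers coincide and the diagonal of B supplies
-- [f(r) < f(r+1)] + [f(r+1) < f(r)] = 1.
module Submission where

open import Defs
open import Algebra.Bundles using (CommutativeRing)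
open import Data.Bool using (Bool; true; false; _xor_; _∧_; _∨_)
open import Data.Bool.Properties
  using (xor-assoc; xor-comm; xor-identityʳ; ∧-zeroʳ; xor-∧-commutativeRing)
open import Data.Bool.Solver using (module xor-∧-Solver)
open import Data.Fin using (Fin; zero; suc; toℕ)
import Data.Fin as F
import Data.Fin.Properties as F
open import Data.Fin.Permutation using (Permutation′; _⟨$⟩ʳ_; _⟨$⟩ˡ_; inverseʳ)
open import Data.Nat
  using (ℕ; zero; suc; _*_; _+_; _≤_; _<_; _≟_; _<?_; _≤?_; _⊓_; _⊔_; z<s; s≤s; s≤s⁻¹)
open import Data.Nat.Properties
open import Data.Sum using (inj₁; inj₂)
open import Function using (_∘_; _⇔_; mk⇔; Equivalence)
open import Relation.Binary using (tri<; tri≈; tri>)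
open import Relation.Binary.PropositionalEquality
open import Relation.Nullary using (¬_; contradiction)
open import Relation.Nullary.Decidable
  using (Dec; ⌊_⌋; yes; no; isYes≗does; does-⇔; dec-true; dec-false)
open import Algebra.Properties.Semiring.Sum (CommutativeRing.semiring xor-∧-commutativeRing)
  using (sum; sum-cong-≗; sum-replicate-zero; *-distribˡ-sum)

open ≡-Reasoning
open Equivalence using (from)

⌊⌋-⇔ : ∀ {A B : Set} → A ⇔ B → (a? : Dec A) (b? : Dec B) → ⌊ a? ⌋ ≡ ⌊ b? ⌋
⌊⌋-⇔ A⇔B a? b? =
  trans (isYes≗does a?) (trans (does-⇔ A⇔B a? b?) (sym (isYes≗does b?)))

⌊⌋-true : ∀ {A : Set} (a? : Dec A) → A → ⌊ a? ⌋ ≡ true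
⌊⌋-true a? a = trans (isYes≗does a?) (dec-true a? a)

⌊⌋-false : ∀ {A : Set} (a? : Dec A) → ¬ A → ⌊ a? ⌋ ≡ false
⌊⌋-false a? ¬a = trans (isYes≗does a?) (dec-false a? ¬a)

prefixSum : (ℕ → Bool) → ℕ → Bool
prefixSum g zero    = g zero
prefixSum g (suc k) = prefixSum g k xor g (suc k)

Δ : (ℕ → Bool) → ℕ → Bool
Δ g zero    = g zero
Δ g (suc k) = g (suc k) xor g k

prefixSum-cong : ∀ {g h} → (∀ r → g r ≡ h r) → ∀ k → prefixSum g k ≡ prefixSum h k
prefixSum-cong g≗h zero    = g≗h zero
prefixSum-cong g≗h (suc k) = cong₂ _xor_ (prefixSum-cong g≗h k) (g≗h (suc k))

prefixSum-head : ∀ g k → prefixSum g (suc k) ≡ g zero xor prefixSum (g ∘ suc) k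
prefixSum-head g zero    = refl
prefixSum-head g (suc k) =
  trans (cong (_xor g (suc (suc k))) (prefixSum-head g k))
        (xor-assoc (g zero) (prefixSum (g ∘ suc) k) (g (suc (suc k))))

prefixSum-Δ : ∀ g k → prefixSum (Δ g) k ≡ g k
prefixSum-Δ g zero    = refl
prefixSum-Δ g (suc k) rewrite prefixSum-Δ g k = cancel (g k) (g (suc k))
  where
  open xor-∧-Solver
  cancel : ∀ a b → a xor (b xor a) ≡ b
  cancel = solve 2 (λ a b → a :+ (b :+ a) := b) refl

prefixSum₂ : (ℕ → ℕ → Bool) → ℕ → ℕ → Bool
prefixSum₂ N a b = prefixSum (λ r → prefixSum (N r) b) a

Δ₂ : (ℕ → ℕ → Bool) → ℕ → ℕ → Bool
Δ₂ P r c = Δ (λ c′ → Δ (λ r′ → P r′ c′) r) c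

prefixSum₂-Δ₂ : ∀ P a b → prefixSum₂ (Δ₂ P) a b ≡ P a b
prefixSum₂-Δ₂ P a b = begin
  prefixSum (λ r → prefixSum (Δ (λ c → Δ (λ r′ → P r′ c) r)) b) a
    ≡⟨ prefixSum-cong (λ r → prefixSum-Δ _ b) a ⟩
  prefixSum (Δ (λ r → P r b)) a
    ≡⟨ prefixSum-Δ _ a ⟩
  P a b ∎

xorSum≡sum : ∀ {k} (h : Fin k → Bool) → xorSum h ≡ sum h
xorSum≡sum {zero}  h = refl
xorSum≡sum {suc k} h = cong (h zero xor_) (xorSum≡sum (h ∘ suc))

sum-≤-guard : ∀ {k} (h : Fin k → Bool) (g : ℕ → Bool) → (∀ r → h r ≡ g (toℕ r)) →
  (i : Fin k) → sum (λ r → ⌊ r F.≤? i ⌋ ∧ h r) ≡ prefixSum g (toℕ i)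
sum-≤-guard {suc k} h g h≗g zero = begin
  h zero xor sum {k} (λ _ → false) ≡⟨ cong₂ _xor_ (h≗g zero) (sum-replicate-zero k) ⟩
  g zero xor false                 ≡⟨ xor-identityʳ _ ⟩
  g zero                           ∎
sum-≤-guard {suc k} h g h≗g (suc i) = begin
  h zero xor sum (λ r → ⌊ suc r F.≤? suc i ⌋ ∧ h (suc r))
    ≡⟨ cong₂ _xor_ (h≗g zero) (sum-cong-≗ λ r →
         cong (_∧ h (suc r)) (⌊⌋-⇔ (mk⇔ s≤s⁻¹ s≤s) (suc r F.≤? suc i) (r F.≤? i))) ⟩
  g zero xor sum (λ r → ⌊ r F.≤? i ⌋ ∧ h (suc r))
    ≡⟨ cong (g zero xor_) (sum-≤-guard (h ∘ suc) (g ∘ suc) (h≗g ∘ suc) i) ⟩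
  g zero xor prefixSum (g ∘ suc) (toℕ i)
    ≡⟨ prefixSum-head g (toℕ i) ⟨
  prefixSum g (suc (toℕ i)) ∎

S≡prefixSum₂ : ∀ {m} (M : Mat m) (N : ℕ → ℕ → Bool) →
  (∀ r c → M r c ≡ N (toℕ r) (toℕ c)) →
  ∀ i j → S M i j ≡ prefixSum₂ N (toℕ i) (toℕ j)
S≡prefixSum₂ M N M≗N i j = begin
  S M i j
    ≡⟨ xorSum≡sum (λ r → xorSum λ c → ⌊ r F.≤? i ⌋ ∧ ⌊ c F.≤? j ⌋ ∧ M r c) ⟩
  sum (λ r → xorSum λ c → ⌊ r F.≤? i ⌋ ∧ ⌊ c F.≤? j ⌋ ∧ M r c)
    ≡⟨ sum-cong-≗ (λ r → trans (xorSum≡sum λ c → ⌊ r F.≤? i ⌋ ∧ ⌊ c F.≤? j ⌋ ∧ M r c)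
         (sym (*-distribˡ-sum ⌊ r F.≤? i ⌋ λ c → ⌊ c F.≤? j ⌋ ∧ M r c))) ⟩
  sum (λ r → ⌊ r F.≤? i ⌋ ∧ sum λ c → ⌊ c F.≤? j ⌋ ∧ M r c)
    ≡⟨ sum-≤-guard _ _ (λ r → sum-≤-guard (M r) (N (toℕ r)) (M≗N r) j) i ⟩
  prefixSum₂ N (toℕ i) (toℕ j) ∎

strictlyBetween-comm : ∀ a b z → strictlyBetween a b z ≡ strictlyBetween b a z
strictlyBetween-comm a b z =
  cong₂ (λ lo hi → ⌊ lo <? z ⌋ ∧ ⌊ z <? hi ⌋) (⊓-comm a b) (⊔-comm a b)

strictlyBetween-endpoint : ∀ a b → strictlyBetween a b b ≡ false
strictlyBetween-endpoint a b with ≤-total a b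
... | inj₁ a≤b rewrite m≤n⇒m⊔n≡n a≤b =
  trans (cong (⌊ a ⊓ b <? b ⌋ ∧_) (⌊⌋-false (b <? b) (n≮n b))) (∧-zeroʳ _)
... | inj₂ b≤a rewrite m≥n⇒m⊓n≡n b≤a =
  cong (_∧ ⌊ b <? a ⊔ b ⌋) (⌊⌋-false (b <? b) (n≮n b))

strictlyBetween-ordered : ∀ {a b z} → a ≤ b → z ≢ b →
  strictlyBetween a b z ≡ ⌊ a <? z ⌋ xor ⌊ b <? z ⌋
strictlyBetween-ordered {a} {b} {z} a≤b z≢b
  rewrite m≤n⇒m⊓n≡m a≤b | m≤n⇒m⊔n≡n a≤b with a <? z | b <? z
... | yes _   | yes b<z = ⌊⌋-false (z <? b) (<-asym b<z)
... | yes _   | no b≮z  = ⌊⌋-true (z <? b) (≤∧≢⇒< (≮⇒≥ b≮z) z≢b)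
... | no a≮z  | yes b<z = contradiction (≤-<-trans a≤b b<z) a≮z
... | no _    | no _    = refl

strictlyBetween-xor : ∀ {a b z} → z ≢ a → z ≢ b →
  strictlyBetween a b z ≡ ⌊ a <? z ⌋ xor ⌊ b <? z ⌋
strictlyBetween-xor {a} {b} {z} z≢a z≢b with ≤-total a b
... | inj₁ a≤b = strictlyBetween-ordered a≤b z≢b
... | inj₂ b≤a = begin
  strictlyBetween a b z     ≡⟨ strictlyBetween-comm a b z ⟩
  strictlyBetween b a z     ≡⟨ strictlyBetween-ordered b≤a z≢a ⟩
  ⌊ b <? z ⌋ xor ⌊ a <? z ⌋ ≡⟨ xor-comm ⌊ b <? z ⌋ ⌊ a <? z ⌋ ⟩
  ⌊ a <? z ⌋ xor ⌊ b <? z ⌋ ∎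

3[1+n]≡1+[3n+2] : ∀ n → 3 * suc n ≡ suc (3 * n + 2)
3[1+n]≡1+[3n+2] n = trans (trans (*-suc 3 n) (+-comm 3 (3 * n))) (+-suc (3 * n) 2)

3m<3n⇔m<n : ∀ m n → 3 * m < 3 * n ⇔ m < n
3m<3n⇔m<n m n = mk⇔ (*-cancelˡ-< 3 m n) (*-monoʳ-< 3)

3m+2<3n+2⇔m<n : ∀ m n → 3 * m + 2 < 3 * n + 2 ⇔ m < n
3m+2<3n+2⇔m<n m n =
  mk⇔ (*-cancelˡ-< 3 m n ∘ +-cancelʳ-< 2 (3 * m) (3 * n)) (+-monoˡ-< 2 ∘ *-monoʳ-< 3)

3m+2<3n⇔m<n : ∀ m n → 3 * m + 2 < 3 * n ⇔ m < n
3m+2<3n⇔m<n m n = mk⇔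
  (λ p → *-cancelˡ-≤ 3 (subst (_≤ 3 * n) (sym (3[1+n]≡1+[3n+2] m)) p))
  (λ p → subst (_≤ 3 * n) (3[1+n]≡1+[3n+2] m) (*-monoʳ-≤ 3 p))

3m<3n+2⇔m≤n : ∀ m n → 3 * m < 3 * n + 2 ⇔ m ≤ n
3m<3n+2⇔m≤n m n = mk⇔
  (λ p → s≤s⁻¹ (*-cancelˡ-< 3 m (suc n)
            (subst (3 * m <_) (sym (3[1+n]≡1+[3n+2] n)) (m<n⇒m<1+n p))))
  (λ p → ≤-<-trans (*-monoʳ-≤ 3 p) (m<m+n (3 * n) z<s))

3m≢3n+2 : ∀ m n → 3 * m ≢ 3 * n + 2
3m≢3n+2 m n e with m ≤? n
... | yes m≤n = <-irrefl e (from (3m<3n+2⇔m≤n m n) m≤n)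
... | no m≰n  = <-irrefl (sym e) (from (3m+2<3n⇔m<n n m) (≰⇒> m≰n))

interleaving-positions : ∀ x₁ x₂ y₁ y₂ → y₂ ≢ x₂ → y₁ ≢ x₁ →
  strictlyBetween (3 * x₂) (3 * x₁ + 2) (3 * y₂) xor
  strictlyBetween (3 * x₂) (3 * x₁ + 2) (3 * y₁ + 2)
  ≡ (⌊ x₂ <? y₂ ⌋ xor ⌊ x₁ <? y₂ ⌋) xor (⌊ x₂ ≤? y₁ ⌋ xor ⌊ x₁ <? y₁ ⌋)
interleaving-positions x₁ x₂ y₁ y₂ y₂≢x₂ y₁≢x₁ = cong₂ _xor_ at-left-end at-right-end
  where
  at-left-end :
    strictlyBetween (3 * x₂) (3 * x₁ + 2) (3 * y₂) ≡ ⌊ x₂ <? y₂ ⌋ xor ⌊ x₁ <? y₂ ⌋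
  at-left-end = trans
    (strictlyBetween-xor (y₂≢x₂ ∘ *-cancelˡ-≡ y₂ x₂ 3) (3m≢3n+2 y₂ x₁))
    (cong₂ _xor_ (⌊⌋-⇔ (3m<3n⇔m<n x₂ y₂) (_ <? _) (_ <? _))
                 (⌊⌋-⇔ (3m+2<3n⇔m<n x₁ y₂) (_ <? _) (_ <? _)))
  at-right-end :
    strictlyBetween (3 * x₂) (3 * x₁ + 2) (3 * y₁ + 2) ≡ ⌊ x₂ ≤? y₁ ⌋ xor ⌊ x₁ <? y₁ ⌋
  at-right-end = trans
    (strictlyBetween-xor (3m≢3n+2 x₂ y₁ ∘ sym)
                         (y₁≢x₁ ∘ *-cancelˡ-≡ y₁ x₁ 3 ∘ +-cancelʳ-≡ 2 (3 * y₁) (3 * x₁)))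
    (cong₂ _xor_ (⌊⌋-⇔ (3m<3n+2⇔m≤n x₂ y₁) (_ <? _) (_ ≤? _))
                 (⌊⌋-⇔ (3m+2<3n+2⇔m<n x₁ y₁) (_ <? _) (_ <? _)))

≤?-xor-≟ : ∀ x y → ⌊ x ≤? y ⌋ xor ⌊ x ≟ y ⌋ ≡ ⌊ x <? y ⌋
≤?-xor-≟ x y with x ≟ y
... | yes refl rewrite ⌊⌋-true (x ≤? x) ≤-refl | ⌊⌋-false (x <? x) (n≮n x) = refl
... | no x≢y =
  trans (xor-identityʳ _) (⌊⌋-⇔ (mk⇔ (λ p → ≤∧≢⇒< p x≢y) <⇒≤) (x ≤? y) (x <? y))

<?-xor->? : ∀ {x y} → x ≢ y → ⌊ x <? y ⌋ xor ⌊ y <? x ⌋ ≡ true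
<?-xor->? {x} {y} x≢y with <-cmp x y
... | tri< x<y _ y≮x rewrite ⌊⌋-true (x <? y) x<y | ⌊⌋-false (y <? x) y≮x = refl
... | tri≈ _ x≡y _   = contradiction x≡y x≢y
... | tri> x≮y _ y<x rewrite ⌊⌋-false (x <? y) x≮y | ⌊⌋-true (y <? x) y<x = refl

⟨$⟩ˡ-injective : ∀ {n} (π : Permutation′ n) {i j} → π ⟨$⟩ˡ i ≡ π ⟨$⟩ˡ j → i ≡ j
⟨$⟩ˡ-injective π {i} {j} e = begin
  i                     ≡⟨ inverseʳ π ⟨
  π ⟨$⟩ʳ (π ⟨$⟩ˡ i)     ≡⟨ cong (π ⟨$⟩ʳ_) e ⟩
  π ⟨$⟩ʳ (π ⟨$⟩ˡ j)     ≡⟨ inverseʳ π ⟩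
  j                     ∎

module _ {n : ℕ} (π : Permutation′ n) where

  private
    f : ℕ → ℕ
    f = fπ π

  precedence : ℕ → ℕ → Bool
  precedence a b = ⌊ f a <? f b ⌋

  fπ-suc-positive : ∀ k → 0 < f (suc k)
  fπ-suc-positive k with k <? n
  ... | yes _ = z<s
  ... | no _  = z<s

  fπ-injective : ∀ {a b} → a ≤ suc n → b ≤ suc n → f a ≡ f b → a ≡ b
  fπ-injective {zero}  {zero}  _ _ _ = refl
  fπ-injective {zero}  {suc b} _ _ e = contradiction e (<⇒≢ (fπ-suc-positive b))
  fπ-injective {suc a} {zero}  _ _ e = contradiction (sym e) (<⇒≢ (fπ-suc-positive a))
  fπ-injective {suc a} {suc b} a≤1+n b≤1+n e with a <? n | b <? n
  ... | yes a<n | yes b<n =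
    cong suc (F.fromℕ<-injective a b a<n b<n
      (⟨$⟩ˡ-injective π (F.toℕ-injective (suc-injective e))))
  ... | yes a<n | no _    = contradiction (suc-injective e) (<⇒≢ (F.toℕ<n _))
  ... | no _    | yes b<n = contradiction (sym (suc-injective e)) (<⇒≢ (F.toℕ<n _))
  ... | no a≮n  | no b≮n  = cong suc (trans (≤-antisym (s≤s⁻¹ a≤1+n) (≮⇒≥ a≮n))
                                            (≤-antisym (≮⇒≥ b≮n) (s≤s⁻¹ b≤1+n)))

  diagonal-entry : ∀ {r} → r < suc n →
    interleave π (suc r) (suc r) xor (⌊ suc r ≟ suc r ⌋ ∨ ⌊ suc (suc r) ≟ suc r ⌋)
    ≡ Δ₂ precedence (suc r) (suc r)
  diagonal-entry {r} r<1+n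
    rewrite strictlyBetween-comm (3 * f (suc r)) (3 * f r + 2) (3 * f (suc r))
          | strictlyBetween-endpoint (3 * f r + 2) (3 * f (suc r))
          | strictlyBetween-endpoint (3 * f (suc r)) (3 * f r + 2)
          | ⌊⌋-true (suc r ≟ suc r) refl
          | ⌊⌋-false (f (suc r) <? f (suc r)) (n≮n _)
          | ⌊⌋-false (f r <? f r) (n≮n _)
          | xor-identityʳ ⌊ f (suc r) <? f r ⌋
    = sym (<?-xor->? (<⇒≢ (n<1+n r) ∘ fπ-injective (<⇒≤ r<1+n) r<1+n))

  off-diagonal-entry : ∀ {r c} → r < suc n → c < suc n → r ≢ c →
    interleave π (suc r) (suc c) xor (⌊ suc r ≟ suc c ⌋ ∨ ⌊ suc (suc r) ≟ suc c ⌋)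
    ≡ Δ₂ precedence (suc r) (suc c)
  off-diagonal-entry {r} {c} r<1+n c<1+n r≢c = begin
    interleave π (suc r) (suc c) xor (⌊ suc r ≟ suc c ⌋ ∨ ⌊ suc (suc r) ≟ suc c ⌋)
      ≡⟨ cong₂ _xor_ (interleaving-positions x₁ x₂ y₁ y₂ y₂≢x₂ y₁≢x₁)
                     (cong₂ _∨_ (⌊⌋-false (suc r ≟ suc c) (r≢c ∘ suc-injective))
                                (⌊⌋-⇔ 2+r≡1+c⇔x₂≡y₁ (suc (suc r) ≟ suc c) (x₂ ≟ y₁))) ⟩
    ((p xor q) xor (⌊ x₂ ≤? y₁ ⌋ xor s)) xor ⌊ x₂ ≟ y₁ ⌋
      ≡⟨ regroup p q ⌊ x₂ ≤? y₁ ⌋ s ⌊ x₂ ≟ y₁ ⌋ ⟩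
    (p xor q) xor ((⌊ x₂ ≤? y₁ ⌋ xor ⌊ x₂ ≟ y₁ ⌋) xor s)
      ≡⟨ cong (λ t → (p xor q) xor (t xor s)) (≤?-xor-≟ x₂ y₁) ⟩
    (p xor q) xor (⌊ x₂ <? y₁ ⌋ xor s) ∎
    where
    x₁ x₂ y₁ y₂ : ℕ
    x₁ = f r
    x₂ = f (suc r)
    y₁ = f c
    y₂ = f (suc c)
    p q s : Bool
    p = ⌊ x₂ <? y₂ ⌋
    q = ⌊ x₁ <? y₂ ⌋
    s = ⌊ x₁ <? y₁ ⌋
    y₂≢x₂ : y₂ ≢ x₂
    y₂≢x₂ = r≢c ∘ sym ∘ suc-injective ∘ fπ-injective c<1+n r<1+n
    y₁≢x₁ : y₁ ≢ x₁
    y₁≢x₁ = r≢c ∘ sym ∘ fπ-injective (<⇒≤ c<1+n) (<⇒≤ r<1+n)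
    2+r≡1+c⇔x₂≡y₁ : suc (suc r) ≡ suc c ⇔ x₂ ≡ y₁
    2+r≡1+c⇔x₂≡y₁ =
      mk⇔ (cong f ∘ suc-injective) (cong suc ∘ fπ-injective r<1+n (<⇒≤ c<1+n))
    regroup : ∀ a b l t e → ((a xor b) xor (l xor t)) xor e ≡ (a xor b) xor ((l xor e) xor t)
    regroup = solve 5
      (λ a b l t e → ((a :+ b) :+ (l :+ t)) :+ e := (a :+ b) :+ ((l :+ e) :+ t)) refl
      where open xor-∧-Solver

  Z-A⊕B≡Δ₂-precedence : ∀ r c →
    (Z (Aπ π) ⊕ B (suc (suc n))) r c ≡ Δ₂ precedence (toℕ r) (toℕ c)
  Z-A⊕B≡Δ₂-precedence zero    zero          = refl
  Z-A⊕B≡Δ₂-precedence zero    (suc zero)    =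
    sym (cong (_xor false) (⌊⌋-true (0 <? f 1) (fπ-suc-positive 0)))
  Z-A⊕B≡Δ₂-precedence zero    (suc (suc c)) = sym (cong₂ _xor_
    (⌊⌋-true (0 <? f (2 + toℕ c)) (fπ-suc-positive _))
    (⌊⌋-true (0 <? f (1 + toℕ c)) (fπ-suc-positive _)))
  Z-A⊕B≡Δ₂-precedence (suc r) zero          = refl
  Z-A⊕B≡Δ₂-precedence (suc r) (suc c) with r F.≟ c
  ... | yes refl = diagonal-entry (F.toℕ<n r)
  ... | no r≢c   = off-diagonal-entry (F.toℕ<n r) (F.toℕ<n c) (r≢c ∘ F.toℕ-injective)

mainTheorem13 : ∀ (n : ℕ) (π : Permutation′ n) (i j : Fin (suc (suc n))) →
    Pπ π i j ≡ S (Z (Aπ π) ⊕ B (suc (suc n))) i j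
mainTheorem13 n π i j = begin
  Pπ π i j
    ≡⟨ prefixSum₂-Δ₂ (precedence π) (toℕ i) (toℕ j) ⟨
  prefixSum₂ (Δ₂ (precedence π)) (toℕ i) (toℕ j)
    ≡⟨ S≡prefixSum₂ (Z (Aπ π) ⊕ B (suc (suc n))) _ (Z-A⊕B≡Δ₂-precedence π) i j ⟨
  S (Z (Aπ π) ⊕ B (suc (suc n))) i j ∎
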